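{- Let $H$ be a MAG, $\zeta$ a sub-determination of $H$, and $W=[\mathbf{u}_1,e_1,\mathbf{u}_2,\dots,e_{k-1},\mathbf{u}_k]$ a walk on $H$. Consider the sequence $S_\zeta(\mathbf{u}_1),S_\zeta(\mathbf{u}_2),\dots,S_\zeta(\mathbf{u}_k)$ and delete every entry that equals the entry immediately preceding it, obtaining $\mathbf{w}_1,\dots,\mathbf{w}_r$ ($r\ge1$) with $\mathbf{w}_j\neq\mathbf{w}_{j+1}$. Then for each $1\le j<r$, the $2m$-tuple $\epsilon_j$ formed by concatenating $\mathbf{w}_j$ and $\mathbf{w}_{j+1}$ is an edge of $M_\zeta(H)$ of the form $E_\zeta(e_n)$ for some edge $e_n$ of $W$, so that $[\mathbf{w}_1,\epsilon_1,\mathbf{w}_2,\dots,\epsilon_{r-1},\mathbf{w}_r]$ is a walk on $M_\zeta(H)$ (possibly consisting of a single composite vertex and no edge).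
   Context: A MultiAspect Graph (MAG) of order $p\ge 1$ is a pair $H=(A,E)$, where $A=[A[1],\dots,A[p]]$ is a finite list of finite sets (aspects) and $E\subseteq A[1]\times\cdots\times A[p]\times A[1]\times\cdots\times A[p]$ is a set of $2p$-tuples called edges. Composite vertices are elements of $\mathbb{V}(H)=A[1]\times\cdots\times A[p]$. For $e=(a_1,\dots,a_p,b_1,\dots,b_p)$, $\pi_o(e)=(a_1,\dots,a_p)$, $\pi_d(e)=(b_1,\dots,b_p)$; edges satisfy $\pi_o(e)\neq\pi_d(e)$. A walk on a MAG $H$ is an alternating sequence $[\mathbf{u}_1,e_1,\dots,e_{k-1},\mathbf{u}_k]$ with $\mathbf{u}_n\in\mathbb{V}(H)$, $e_n\in E(H)$, $\mathbf{u}_n=\pi_o(e_n)$, $\mathbf{u}_{n+1}=\pi_d(e_n)$. A sub-determination $\zeta$ (for $p\ge2$) is a choice of indices $1\le\zeta_1<\cdots<\zeta_m\le p$ with $1\le m<p$; it defines $S_\zeta(a_1,\dots,a_p)=(a_{\zeta_1},\dots,a_{\zeta_m})$ and $E_\zeta(a_1,\dots,a_p,b_1,\dots,b_p)=(a_{\zeta_1},\dots,a_{\zeta_m},b_{\zeta_1},\dots,b_{\zeta_m})$. The sub-determined MAG is the order-$m$ MAG $M_\zeta(H)=([A[\zeta_1],\dots,A[\zeta_m]],\,\{E_\zeta(e): e\in E(H),\ S_\zeta(\pi_o(e))\neq S_\zeta(\pi_d(e))\})$. -}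

module Defs where

open import Data.Nat using (ℕ; zero; suc; _≤_)
open import Data.Fin using (Fin; zero; suc; _<_)
import Data.Fin.Properties as FinP
open import Data.Product using (Σ; _×_; _,_; proj₁; proj₂)
open import Data.Product.Properties using (≡-dec)
open import Data.Unit using (⊤; tt)
open import Data.List using (List; []; _∷_; map; derun)
open import Relation.Binary.PropositionalEquality using (_≡_; _≢_)
open import Relation.Binary.Definitions using (DecidableEquality)
open import Relation.Nullary using (yes; no)

-- Composite vertices of a MAG of order p whose i-th aspect is the finite
-- set Fin (s i):  A[1] × ⋯ × A[p]  as an iterated product.
Tuple : (p : ℕ) → (Fin p → ℕ) → Set
Tuple zero    s = ⊤
Tuple (suc p) s = Fin (s zero) × Tuple p (λ i → s (suc i))

_≟T_ : ∀ {p s} → DecidableEquality (Tuple p s)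
_≟T_ {zero}  tt tt = yes _≡_.refl
_≟T_ {suc p} = ≡-dec FinP._≟_ _≟T_

get : ∀ {p s} → Tuple p s → (i : Fin p) → Fin (s i)
get {suc p} (a , x) zero    = a
get {suc p} (a , x) (suc i) = get x i

build : ∀ {m} (t : Fin m → ℕ) → ((j : Fin m) → Fin (t j)) → Tuple m t
build {zero}  t f = tt
build {suc m} t f = f zero , build (λ j → t (suc j)) (λ j → f (suc j))

-- A MAG H = (A, E) of order p ≥ 1. Aspect A[i] = Fin (size i).
-- The edge set E ⊆ 𝕍(H) × 𝕍(H) (2p-tuples written as pairs
-- (π_o e, π_d e)) is given as a relation, with π_o e ≠ π_d e.
record MAG : Set₁ where
  field
    order    : ℕ
    order≥1  : 1 ≤ order
    size     : Fin order → ℕ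
    Edge     : Tuple order size → Tuple order size → Set
    loopless : ∀ {u v} → Edge u v → u ≢ v

  V : Set
  V = Tuple order size

open MAG public

record SubDet (H : MAG) : Set where
  field
    m       : ℕ
    m≥1     : 1 ≤ m
    m<p     : suc m ≤ order H
    idx     : Fin m → Fin (order H)
    strict  : ∀ {i j} → i < j → idx i < idx j

open SubDet public

subSize : (H : MAG) (ζ : SubDet H) → Fin (m ζ) → ℕ
subSize H ζ j = size H (idx ζ j)

S : (H : MAG) (ζ : SubDet H) → V H → Tuple (m ζ) (subSize H ζ)
S H ζ u = build (subSize H ζ) (λ j → get u (idx ζ j))

Eζ : (H : MAG) (ζ : SubDet H) → V H × V H →
     Tuple (m ζ) (subSize H ζ) × Tuple (m ζ) (subSize H ζ)
Eζ H ζ (u , v) = S H ζ u , S H ζ v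

Msub : (H : MAG) (ζ : SubDet H) → MAG
Msub H ζ = record
  { order    = m ζ
  ; order≥1  = m≥1 ζ
  ; size     = subSize H ζ
  ; Edge     = λ x y → Σ (V H × V H) λ e →
                 Edge H (proj₁ e) (proj₂ e)
               × S H ζ (proj₁ e) ≢ S H ζ (proj₂ e)
               × Eζ H ζ e ≡ (x , y)
  ; loopless = λ { (e , _ , ne , _≡_.refl) → ne }
  }

data Walk (H : MAG) : V H → Set where
  single : (u : V H) → Walk H u
  step   : (u v : V H) → Edge H u v → Walk H v → Walk H u

vertices : ∀ {H u} → Walk H u → List (V H)
vertices (single u)     = u ∷ []
vertices (step u v e w) = u ∷ vertices w

edges : ∀ {H u} → Walk H u → List (V H × V H)
edges (single u)     = []
edges (step u v e w) = (u , v) ∷ edges w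

compress : ∀ {p s} → List (Tuple p s) → List (Tuple p s)
compress = derun _≟T_

-- A step e = (u, v) of W whose
-- endpoints have the same projection is dropped, which is exactly what
-- derun does to the repeated entry S u = S v; any other step becomes the
-- edge E_ζ(e) of M_ζ(H), which exists precisely because S u ≢ S v.
module Submission where

open import Defs
open import Data.Product using (Σ; _×_; _,_)
open import Data.List using (List; []; _∷_; map)
open import Data.List.Relation.Unary.All using (All; []; _∷_)
import Data.List.Relation.Unary.All as All
open import Data.List.Relation.Unary.Any using (here; there)
open import Data.List.Membership.Propositional using (_∈_)
open import Relation.Binary.PropositionalEquality
  using (_≡_; refl; sym; trans; cong; subst)
open import Relation.Nullary using (yes; no)

module _ {H : MAG} where

  retarget : ∀ {u v} → u ≡ v → Walk H v → Walk H u
  retarget refl w = w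

  vertices-retarget : ∀ {u v} (p : u ≡ v) (w : Walk H v) →
                      vertices (retarget p w) ≡ vertices w
  vertices-retarget refl w = refl

  edges-retarget : ∀ {u v} (p : u ≡ v) (w : Walk H v) →
                   edges (retarget p w) ≡ edges w
  edges-retarget refl w = refl

  laterVertices : ∀ {u} → Walk H u → List (V H)
  laterVertices (single u)     = []
  laterVertices (step u v e w) = vertices w

  map-vertices : ∀ {B : Set} {u} (f : V H → B) (w : Walk H u) →
                 map f (vertices w) ≡ f u ∷ map f (laterVertices w)
  map-vertices f (single u)     = refl
  map-vertices f (step u v e w) = refl

module _ (H : MAG) (ζ : SubDet H) where

  project : ∀ {u} → Walk H u → Walk (Msub H ζ) (S H ζ u)
  project (single u) = single (S H ζ u)
  project (step u v e w) with S H ζ u ≟T S H ζ v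
  ... | yes Su≡Sv = retarget Su≡Sv (project w)
  ... | no  Su≢Sv = step (S H ζ u) (S H ζ v) ((u , v) , e , Su≢Sv , refl) (project w)

  vertices-project : ∀ {u} (w : Walk H u) →
    vertices (project w) ≡ compress (map (S H ζ) (vertices w))
  vertices-project (single u) = refl
  -- Exposing S v as the second entry lets derun reduce on the same test as project.
  vertices-project (step u v e w)
    with trans (vertices-project w) (cong compress (map-vertices (S H ζ) w))
  ... | ih rewrite map-vertices (S H ζ) w with S H ζ u ≟T S H ζ v
  ...   | yes Su≡Sv = trans (vertices-retarget Su≡Sv (project w)) ih
  ...   | no  Su≢Sv = cong (S H ζ u ∷_) ih

  edges-project : ∀ {u} (w : Walk H u) →
    All (_∈ map (Eζ H ζ) (edges w)) (edges (project w))
  edges-project (single u) = []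
  edges-project (step u v e w) with S H ζ u ≟T S H ζ v
  ... | yes Su≡Sv = subst (All _) (sym (edges-retarget Su≡Sv (project w)))
                          (All.map there (edges-project w))
  ... | no  Su≢Sv = here refl ∷ All.map there (edges-project w)

theorem7 : (H : MAG) (ζ : SubDet H) (u₁ : V H) (W : Walk H u₁) →
    Σ (V (Msub H ζ)) λ w₁ → Σ (Walk (Msub H ζ) w₁) λ W′ →
      (vertices W′ ≡ compress (map (S H ζ) (vertices W)))
      × All (λ ε → ε ∈ map (Eζ H ζ) (edges W)) (edges W′)
theorem7 H ζ u₁ W =
  S H ζ u₁ , project H ζ W , vertices-project H ζ W , edges-project H ζ W
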